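{- For every integer $s\ge2$, $\Gamma(4)/\Gamma(2^s)=G(4)/G(2^s)$.
   Context: Let $\phi=\frac{1+\sqrt5}{2}$, and let $\Gamma\subset \mathrm{SL}_2(\mathbb Z[\phi])$ be the group generated by $\begin{pmatrix}1&\phi\\0&1\end{pmatrix}$, $\begin{pmatrix}1&0\\\phi&1\end{pmatrix}$, $\begin{pmatrix}\phi&\phi\\1&\phi\end{pmatrix}$, $\begin{pmatrix}\phi&1\\\phi&\phi\end{pmatrix}$. Let $G=\mathrm{SL}_2(\mathbb Z[\phi])$. For an integer $q\ge1$, let $\pi_q:G\to\mathrm{SL}_2(\mathbb Z[\phi]/q\mathbb Z[\phi])$ be reduction mod $q$, $G(q)=\ker\pi_q$, $\Gamma(q)=\Gamma\cap\ker\pi_q$. For $q_0\mid q$, $\Gamma(q_0)/\Gamma(q)$ and $G(q_0)/G(q)$ denote the images $\pi_q(\Gamma(q_0))$ and $\pi_q(G(q_0))$ in $\pi_q(G)$. -}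

module Defs where

open import Data.Nat using (ℕ)
open import Data.Integer using (ℤ; +_; -[1+_]; _+_; _*_; _-_; -_)
open import Data.Integer.Divisibility using (_∣_)
open import Data.Fin using (Fin; zero; suc)
open import Data.Bool using (Bool; true; false)
open import Data.List using (List; []; _∷_)
open import Data.Product using (_×_; ∃)
open import Relation.Binary.PropositionalEquality using (_≡_)

-- Elements of ℤ[φ], φ = (1+√5)/2, written a + bφ (basis 1, φ), with φ² = φ + 1.
record Zφ : Set where
  constructor zφ
  field
    re : ℤ
    ph : ℤ
open Zφ public


0φ 1φ φ : Zφ
0φ = zφ (+ 0) (+ 0)
1φ = zφ (+ 1) (+ 0)
φ  = zφ (+ 0) (+ 1)

_⊕_ : Zφ → Zφ → Zφ
(zφ a b) ⊕ (zφ c d) = zφ (a + c) (b + d)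

_⊖_ : Zφ → Zφ → Zφ
(zφ a b) ⊖ (zφ c d) = zφ (a - c) (b - d)

⊝_ : Zφ → Zφ
⊝ (zφ a b) = zφ (- a) (- b)

-- (a + bφ)(c + dφ) = (ac + bd) + (ad + bc + bd)φ
_⊗_ : Zφ → Zφ → Zφ
(zφ a b) ⊗ (zφ c d) = zφ (a * c + b * d) (a * d + b * c + b * d)

_≡φ_[mod_] : Zφ → Zφ → ℤ → Set
x ≡φ y [mod q ] = (q ∣ re (x ⊖ y)) × (q ∣ ph (x ⊖ y))

record Mat : Set where
  constructor mat
  field
    m11 m12 m21 m22 : Zφ
open Mat public

_·_ : Mat → Mat → Mat
mat a b c d · mat a' b' c' d' =
  mat ((a ⊗ a') ⊕ (b ⊗ c')) ((a ⊗ b') ⊕ (b ⊗ d'))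
      ((c ⊗ a') ⊕ (d ⊗ c')) ((c ⊗ b') ⊕ (d ⊗ d'))

I₂ : Mat
I₂ = mat 1φ 0φ 0φ 1φ

det : Mat → Zφ
det (mat a b c d) = (a ⊗ d) ⊖ (b ⊗ c)

-- adjugate; the inverse for determinant-one matrices
adj : Mat → Mat
adj (mat a b c d) = mat d (⊝ b) (⊝ c) a

InG : Mat → Set
InG M = det M ≡ 1φ

gen : Fin 4 → Mat
gen zero = mat 1φ φ 0φ 1φ
gen (suc zero) = mat 1φ 0φ φ 1φ
gen (suc (suc zero)) = mat φ φ 1φ φ
gen (suc (suc (suc zero))) = mat φ 1φ φ φ

-- a generator (false) or its inverse (true)
letter : Fin 4 × Bool → Mat
letter (i Data.Product., false) = gen i
letter (i Data.Product., true) = adj (gen i)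

evalWord : List (Fin 4 × Bool) → Mat
evalWord [] = I₂
evalWord (l ∷ w) = letter l · evalWord w

InΓ : Mat → Set
InΓ M = ∃ λ (w : List (Fin 4 × Bool)) → evalWord w ≡ M

_≡M_[mod_] : Mat → Mat → ℤ → Set
M ≡M N [mod q ] =
  (m11 M ≡φ m11 N [mod q ]) × (m12 M ≡φ m12 N [mod q ]) ×
  (m21 M ≡φ m21 N [mod q ]) × (m22 M ≡φ m22 N [mod q ])

-- H(q₀) = H ∩ ker π_{q₀}
Level : (Mat → Set) → ℤ → Mat → Set
Level H q₀ M = H M × (M ≡M I₂ [mod q₀ ])

-- X (a representative) lies in π_q(S): some M ∈ S reduces to the class of X mod q
InImage : (Mat → Set) → ℤ → Mat → Set
InImage S q X = ∃ λ M → S M × (M ≡M X [mod q ])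

{-# OPTIONS --safe #-}
module Submission where

-- Γ(4) is shown to fill G(4) modulo 4t for t = 1, 2, 4, … by induction. If a word A ∈ Γ(4)
-- agrees with M ∈ G(4) modulo 4t, then N = A⁻¹M = I + 4tX lies in G, and det N = 1 forces
-- tr X to be even. Any such X is realised by a word U ≡ I + 4tX (mod 8t), and then AU ≡ M
-- (mod 8t). At t = 1 the realisable X are closed under addition (multiply the words) and
-- under change modulo 2, and six explicit words realise x·I, x·E₁₂, x·E₂₁ for x ∈ {1, φ},
-- which span the matrices of even trace modulo 2. Squaring a word passes from t to 2t,
-- because (I + 4tY)² = I + 8tY + 16t²Y².

open import Defs
open import Data.Nat using (ℕ; _≤_; _^_)
open import Data.Integer using (+_)
open import Data.Product using (_×_)

open import Algebra.Bundles using (CommutativeRing)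
import Algebra.Properties.Group as GroupProperties
open import Data.Bool using (Bool; true; false)
open import Data.Fin using (Fin; zero; suc; _↑ʳ_; #_)
open import Data.Integer using (ℤ; _+_; _*_; NonZero; _%ℕ_; _/ℕ_)
open import Data.Integer.DivMod using (a≡a%ℕn+[a/ℕn]*n; n%ℕd<d)
open import Data.Integer.Divisibility using (_∣_)
open import Data.Integer.Divisibility.Signed using (divides; ∣ᵤ⇒∣; ∣⇒∣ᵤ)
import Data.Integer.Properties as ℤ
import Data.Integer.Tactic.RingSolver as ℤ-Solver
open import Data.List using (List; []; _∷_; _++_; map)
open import Data.Maybe using (just; nothing)
import Data.Nat as ℕ
open import Data.Nat.Properties using (m^n≢0)
open import Data.Product using (_,_; ∃)
open import Data.Vec using (Vec; []; _∷_)
open import Level using (0ℓ)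
open import Relation.Binary.PropositionalEquality
open import Algebra.Definitions {A = Zφ} _≡_
open import Algebra.Structures {A = Zφ} _≡_ using (IsCommutativeRing)
open import Tactic.RingSolver.Core.AlmostCommutativeRing
  using (AlmostCommutativeRing; fromCommutativeRing)
open import Tactic.RingSolver.Core.Expression using (Expr; Κ; Ι)
  renaming (_⊕_ to _:+_; _⊗_ to _:*_; ⊝_ to :-_)
import Tactic.RingSolver.NonReflective as NonReflective

-- The commutative ring ℤ[φ]

module ℤ-Ops = NonReflective.Ops ℤ-Solver.ring

-- ZφExpr has polynomial coordinates and ⟦_⟧φ commutes with ⊕ᴱ, ⊗ᴱ definitionally, so each
-- law of ℤ[φ] becomes two polynomial identities over ℤ.
record ZφExpr (n : ℕ) : Set where
  constructor zφᴱ
  field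
    reᴱ phᴱ : Expr ℤ n
open ZφExpr

infixl 6 _⊕ᴱ_
infixl 7 _⊗ᴱ_

_⊕ᴱ_ : ∀ {n} → ZφExpr n → ZφExpr n → ZφExpr n
zφᴱ a b ⊕ᴱ zφᴱ c d = zφᴱ (a :+ c) (b :+ d)

_⊗ᴱ_ : ∀ {n} → ZφExpr n → ZφExpr n → ZφExpr n
zφᴱ a b ⊗ᴱ zφᴱ c d = zφᴱ (a :* c :+ b :* d) (a :* d :+ b :* c :+ b :* d)

1ᴱ : ∀ {n} → ZφExpr n
1ᴱ = zφᴱ (Κ (+ 1)) (Κ (+ 0))

⟦_⟧φ : ∀ {n} → ZφExpr n → Vec ℤ n → Zφ
⟦ zφᴱ a b ⟧φ ρ = zφ (ℤ-Ops.⟦ a ⟧ ρ) (ℤ-Ops.⟦ b ⟧ ρ)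

proveφ : ∀ {n} (ρ : Vec ℤ n) (x y : ZφExpr n) →
         ℤ-Ops.⟦ reᴱ x ⇓⟧ ρ ≡ ℤ-Ops.⟦ reᴱ y ⇓⟧ ρ → ℤ-Ops.⟦ phᴱ x ⇓⟧ ρ ≡ ℤ-Ops.⟦ phᴱ y ⇓⟧ ρ →
         ⟦ x ⟧φ ρ ≡ ⟦ y ⟧φ ρ
proveφ ρ (zφᴱ a b) (zφᴱ c d) re≡ ph≡ = cong₂ zφ (ℤ-Ops.prove ρ a c re≡) (ℤ-Ops.prove ρ b d ph≡)

varφ : ∀ {n} (k : ℕ) → ZφExpr (k ℕ.+ (2 ℕ.+ n))
varφ k = zφᴱ (Ι (k ↑ʳ zero)) (Ι (k ↑ʳ suc zero))

⊕-assoc : Associative _⊕_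
⊕-assoc (zφ a b) (zφ c d) (zφ e f) = cong₂ zφ (ℤ.+-assoc a c e) (ℤ.+-assoc b d f)

⊕-comm : Commutative _⊕_
⊕-comm (zφ a b) (zφ c d) = cong₂ zφ (ℤ.+-comm a c) (ℤ.+-comm b d)

⊕-identityˡ : LeftIdentity 0φ _⊕_
⊕-identityˡ (zφ a b) = cong₂ zφ (ℤ.+-identityˡ a) (ℤ.+-identityˡ b)

⊕-identityʳ : RightIdentity 0φ _⊕_
⊕-identityʳ (zφ a b) = cong₂ zφ (ℤ.+-identityʳ a) (ℤ.+-identityʳ b)

⊕-inverseˡ : LeftInverse 0φ ⊝_ _⊕_
⊕-inverseˡ (zφ a b) = cong₂ zφ (ℤ.+-inverseˡ a) (ℤ.+-inverseˡ b)

⊕-inverseʳ : RightInverse 0φ ⊝_ _⊕_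
⊕-inverseʳ (zφ a b) = cong₂ zφ (ℤ.+-inverseʳ a) (ℤ.+-inverseʳ b)

⊗-assoc : Associative _⊗_
⊗-assoc (zφ a b) (zφ c d) (zφ e f) =
  proveφ (a ∷ b ∷ c ∷ d ∷ e ∷ f ∷ []) ((x ⊗ᴱ y) ⊗ᴱ z) (x ⊗ᴱ (y ⊗ᴱ z)) refl refl
  where
  x y z : ZφExpr 6
  x = varφ 0; y = varφ 2; z = varφ 4

⊗-comm : Commutative _⊗_
⊗-comm (zφ a b) (zφ c d) = proveφ (a ∷ b ∷ c ∷ d ∷ []) (x ⊗ᴱ y) (y ⊗ᴱ x) refl refl
  where
  x y : ZφExpr 4
  x = varφ 0; y = varφ 2

⊗-identityˡ : LeftIdentity 1φ _⊗_
⊗-identityˡ (zφ a b) = proveφ (a ∷ b ∷ []) (1ᴱ ⊗ᴱ varφ 0) (varφ 0) refl refl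

⊗-identityʳ : RightIdentity 1φ _⊗_
⊗-identityʳ (zφ a b) = proveφ (a ∷ b ∷ []) (varφ 0 ⊗ᴱ 1ᴱ) (varφ 0) refl refl

⊗-distribˡ : _⊗_ DistributesOverˡ _⊕_
⊗-distribˡ (zφ a b) (zφ c d) (zφ e f) =
  proveφ (a ∷ b ∷ c ∷ d ∷ e ∷ f ∷ []) (x ⊗ᴱ (y ⊕ᴱ z)) (x ⊗ᴱ y ⊕ᴱ x ⊗ᴱ z) refl refl
  where
  x y z : ZφExpr 6
  x = varφ 0; y = varφ 2; z = varφ 4

⊗-distribʳ : _⊗_ DistributesOverʳ _⊕_
⊗-distribʳ (zφ a b) (zφ c d) (zφ e f) =
  proveφ (a ∷ b ∷ c ∷ d ∷ e ∷ f ∷ []) ((y ⊕ᴱ z) ⊗ᴱ x) (y ⊗ᴱ x ⊕ᴱ z ⊗ᴱ x) refl refl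
  where
  x y z : ZφExpr 6
  x = varφ 0; y = varφ 2; z = varφ 4

Zφ-isCommutativeRing : IsCommutativeRing _⊕_ _⊗_ ⊝_ 0φ 1φ
Zφ-isCommutativeRing = record
  { isRing = record
    { +-isAbelianGroup = record
      { isGroup = record
        { isMonoid = record
          { isSemigroup = record
            { isMagma = record { isEquivalence = isEquivalence ; ∙-cong = cong₂ _⊕_ }
            ; assoc = ⊕-assoc
            }
          ; identity = ⊕-identityˡ , ⊕-identityʳ
          }
        ; inverse = ⊕-inverseˡ , ⊕-inverseʳ
        ; ⁻¹-cong = cong ⊝_
        }
      ; comm = ⊕-comm
      }
    ; *-cong = cong₂ _⊗_
    ; *-assoc = ⊗-assoc
    ; *-identity = ⊗-identityˡ , ⊗-identityʳ
    ; distrib = ⊗-distribˡ , ⊗-distribʳ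
    }
  ; *-comm = ⊗-comm
  }

Zφ-commutativeRing : CommutativeRing 0ℓ 0ℓ
Zφ-commutativeRing = record { isCommutativeRing = Zφ-isCommutativeRing }

open GroupProperties (CommutativeRing.+-group Zφ-commutativeRing)
  using (inverseˡ-unique; identityʳ-unique)

fromℤ : ℤ → Zφ
fromℤ k = zφ k (+ 0)

2φ 4φ 8φ : Zφ
2φ = fromℤ (+ 2)
4φ = fromℤ (+ 4)
8φ = fromℤ (+ 8)

fromℤ-⊗ : ∀ k a b → fromℤ k ⊗ zφ a b ≡ zφ (k * a) (k * b)
fromℤ-⊗ k a b = proveφ (k ∷ a ∷ b ∷ []) (zφᴱ κ (Κ (+ 0)) ⊗ᴱ varφ 1) (zφᴱ (κ :* α) (κ :* β)) refl refl
  where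
  κ α β : Expr ℤ 3
  κ = Ι zero; α = Ι (suc zero); β = Ι (suc (suc zero))

Cancellable : Zφ → Set
Cancellable s = ∀ y → s ⊗ y ≡ 0φ → y ≡ 0φ

fromℤ-cancellable : ∀ k .{{_ : NonZero k}} → Cancellable (fromℤ k)
fromℤ-cancellable k (zφ a b) k⊗y≡0 = cong₂ zφ (cancel (cong re ka,kb≡0)) (cancel (cong ph ka,kb≡0))
  where
  ka,kb≡0 : zφ (k * a) (k * b) ≡ 0φ
  ka,kb≡0 = trans (sym (fromℤ-⊗ k a b)) k⊗y≡0
  cancel : ∀ {c} → k * c ≡ + 0 → c ≡ + 0
  cancel {c} kc≡0 = ℤ.*-cancelˡ-≡ k c (+ 0) (trans kc≡0 (sym (ℤ.*-zeroʳ k)))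

-- A ring solver for matrices over ℤ[φ]

Zφ-ring : AlmostCommutativeRing 0ℓ 0ℓ
Zφ-ring = fromCommutativeRing Zφ-commutativeRing λ where
  (zφ (+ 0) (+ 0)) → just refl
  _ → nothing

module Zφ-Ops = NonReflective.Ops Zφ-ring

varˢ : ∀ {n} (k : ℕ) → Expr Zφ (k ℕ.+ ℕ.suc n)
varˢ k = Ι (k ↑ʳ zero)

-- Likewise the operations on MatExpr copy those on Mat, so a matrix identity becomes four
-- polynomial identities over ℤ[φ].
record MatExpr (n : ℕ) : Set where
  constructor matᴱ
  field
    e₁₁ e₁₂ e₂₁ e₂₂ : Expr Zφ n
open MatExpr

⟦_⟧ᴹ : ∀ {n} → MatExpr n → Vec Zφ n → Mat
⟦ matᴱ a b c d ⟧ᴹ ρ = mat (Zφ-Ops.⟦ a ⟧ ρ) (Zφ-Ops.⟦ b ⟧ ρ) (Zφ-Ops.⟦ c ⟧ ρ) (Zφ-Ops.⟦ d ⟧ ρ)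

mat-cong : ∀ {a b c d a′ b′ c′ d′} → a ≡ a′ → b ≡ b′ → c ≡ c′ → d ≡ d′ → mat a b c d ≡ mat a′ b′ c′ d′
mat-cong refl refl refl refl = refl

proveᴹ : ∀ {n} (ρ : Vec Zφ n) (A B : MatExpr n) →
         Zφ-Ops.⟦ e₁₁ A ⇓⟧ ρ ≡ Zφ-Ops.⟦ e₁₁ B ⇓⟧ ρ → Zφ-Ops.⟦ e₁₂ A ⇓⟧ ρ ≡ Zφ-Ops.⟦ e₁₂ B ⇓⟧ ρ →
         Zφ-Ops.⟦ e₂₁ A ⇓⟧ ρ ≡ Zφ-Ops.⟦ e₂₁ B ⇓⟧ ρ → Zφ-Ops.⟦ e₂₂ A ⇓⟧ ρ ≡ Zφ-Ops.⟦ e₂₂ B ⇓⟧ ρ →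
         ⟦ A ⟧ᴹ ρ ≡ ⟦ B ⟧ᴹ ρ
proveᴹ ρ (matᴱ a b c d) (matᴱ a′ b′ c′ d′) p q r s =
  mat-cong (Zφ-Ops.prove ρ a a′ p) (Zφ-Ops.prove ρ b b′ q)
           (Zφ-Ops.prove ρ c c′ r) (Zφ-Ops.prove ρ d d′ s)

infixr 5 _∷ᴹ_
_∷ᴹ_ : ∀ {n} → Mat → Vec Zφ n → Vec Zφ (4 ℕ.+ n)
mat a b c d ∷ᴹ ρ = a ∷ b ∷ c ∷ d ∷ ρ

-- the matrix pushed onto the environment by _∷ᴹ_ at offset k
varᴹ : ∀ {n} (k : ℕ) → MatExpr (k ℕ.+ (4 ℕ.+ n))
varᴹ k = matᴱ (Ι (k ↑ʳ zero)) (Ι (k ↑ʳ suc zero))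
              (Ι (k ↑ʳ suc (suc zero))) (Ι (k ↑ʳ suc (suc (suc zero))))

infixl 6 _⊞_ _⊞ᴱ_
infixr 7 _⊛_ _⊛ᴱ_
infixl 8 _·ᴱ_

_⊞_ : Mat → Mat → Mat
mat a b c d ⊞ mat a′ b′ c′ d′ = mat (a ⊕ a′) (b ⊕ b′) (c ⊕ c′) (d ⊕ d′)

_⊛_ : Zφ → Mat → Mat
s ⊛ mat a b c d = mat (s ⊗ a) (s ⊗ b) (s ⊗ c) (s ⊗ d)

tr : Mat → Zφ
tr (mat a _ _ d) = a ⊕ d

0M : Mat
0M = mat 0φ 0φ 0φ 0φ

constᴹ : ∀ {n} → Mat → MatExpr n
constᴹ (mat a b c d) = matᴱ (Κ a) (Κ b) (Κ c) (Κ d)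

Iᴱ : ∀ {n} → MatExpr n
Iᴱ = constᴹ I₂

_⊞ᴱ_ : ∀ {n} → MatExpr n → MatExpr n → MatExpr n
matᴱ a b c d ⊞ᴱ matᴱ a′ b′ c′ d′ = matᴱ (a :+ a′) (b :+ b′) (c :+ c′) (d :+ d′)

_⊛ᴱ_ : ∀ {n} → Expr Zφ n → MatExpr n → MatExpr n
s ⊛ᴱ matᴱ a b c d = matᴱ (s :* a) (s :* b) (s :* c) (s :* d)

_·ᴱ_ : ∀ {n} → MatExpr n → MatExpr n → MatExpr n
matᴱ a b c d ·ᴱ matᴱ a′ b′ c′ d′ =
  matᴱ (a :* a′ :+ b :* c′) (a :* b′ :+ b :* d′) (c :* a′ :+ d :* c′) (c :* b′ :+ d :* d′)

adjᴱ : ∀ {n} → MatExpr n → MatExpr n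
adjᴱ (matᴱ a b c d) = matᴱ d (:- b) (:- c) a

detᴱ trᴱ : ∀ {n} → MatExpr n → Expr Zφ n
detᴱ (matᴱ a b c d) = a :* d :+ :- (b :* c)
trᴱ (matᴱ a _ _ d) = a :+ d

·-assoc : ∀ A B C → (A · B) · C ≡ A · (B · C)
·-assoc A B C = proveᴹ (A ∷ᴹ B ∷ᴹ C ∷ᴹ []) ((a ·ᴱ b) ·ᴱ c) (a ·ᴱ (b ·ᴱ c)) refl refl refl refl
  where
  a b c : MatExpr 12
  a = varᴹ 0; b = varᴹ 4; c = varᴹ 8

·-identityˡ : ∀ A → I₂ · A ≡ A
·-identityˡ A = proveᴹ (A ∷ᴹ []) (Iᴱ ·ᴱ varᴹ 0) (varᴹ 0) refl refl refl refl

⊛-zeroˡ : ∀ A → 0φ ⊛ A ≡ 0M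
⊛-zeroˡ A = proveᴹ (A ∷ᴹ []) (Κ 0φ ⊛ᴱ varᴹ 0) (constᴹ 0M) refl refl refl refl

⊛-distribʳ : ∀ x y A → (x ⊕ y) ⊛ A ≡ x ⊛ A ⊞ y ⊛ A
⊛-distribʳ x y A = proveᴹ (A ∷ᴹ x ∷ y ∷ []) ((ξ :+ η) ⊛ᴱ a) (ξ ⊛ᴱ a ⊞ᴱ η ⊛ᴱ a) refl refl refl refl
  where
  a : MatExpr 6
  a = varᴹ 0
  ξ η : Expr Zφ 6
  ξ = varˢ 4; η = varˢ 5

⊛-assoc : ∀ x y A → (x ⊗ y) ⊛ A ≡ x ⊛ y ⊛ A
⊛-assoc x y A = proveᴹ (A ∷ᴹ x ∷ y ∷ []) ((ξ :* η) ⊛ᴱ a) (ξ ⊛ᴱ η ⊛ᴱ a) refl refl refl refl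
  where
  a : MatExpr 6
  a = varᴹ 0
  ξ η : Expr Zφ 6
  ξ = varˢ 4; η = varˢ 5

det-· : ∀ A B → det (A · B) ≡ det A ⊗ det B
det-· A B = Zφ-Ops.prove (A ∷ᴹ B ∷ᴹ []) (detᴱ (a ·ᴱ b)) (detᴱ a :* detᴱ b) refl
  where
  a b : MatExpr 8
  a = varᴹ 0; b = varᴹ 4

det-adj : ∀ A → det (adj A) ≡ det A
det-adj A = Zφ-Ops.prove (A ∷ᴹ []) (detᴱ (adjᴱ (varᴹ 0))) (detᴱ (varᴹ 0)) refl

adj-· : ∀ A → adj A · A ≡ det A ⊛ I₂
adj-· A = proveᴹ (A ∷ᴹ []) (adjᴱ (varᴹ 0) ·ᴱ varᴹ 0) (detᴱ (varᴹ 0) ⊛ᴱ Iᴱ) refl refl refl refl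

·-adj : ∀ A → A · adj A ≡ det A ⊛ I₂
·-adj A = proveᴹ (A ∷ᴹ []) (varᴹ 0 ·ᴱ adjᴱ (varᴹ 0)) (detᴱ (varᴹ 0) ⊛ᴱ Iᴱ) refl refl refl refl

adj-inverseˡ : ∀ A → InG A → adj A · A ≡ I₂
adj-inverseˡ A detA = trans (adj-· A) (cong (_⊛ I₂) detA)

adj-inverseʳ : ∀ A → InG A → A · adj A ≡ I₂
adj-inverseʳ A detA = trans (·-adj A) (cong (_⊛ I₂) detA)

adj-·-inG : ∀ A M → InG A → InG M → InG (adj A · M)
adj-·-inG A M detA detM = trans (det-· (adj A) M) (cong₂ _⊗_ (trans (det-adj A) detA) detM)

·-adj-·-cancel : ∀ A M → InG A → A · (adj A · M) ≡ M
·-adj-·-cancel A M detA = begin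
  A · (adj A · M)  ≡⟨ ·-assoc A (adj A) M ⟨
  (A · adj A) · M  ≡⟨ cong (_· M) (adj-inverseʳ A detA) ⟩
  I₂ · M           ≡⟨ ·-identityˡ M ⟩
  M                ∎
  where open ≡-Reasoning

det-I+sX : ∀ s X → det (I₂ ⊞ s ⊛ X) ≡ 1φ ⊕ (s ⊗ (tr X ⊕ (s ⊗ det X)))
det-I+sX s X =
  Zφ-Ops.prove (X ∷ᴹ s ∷ []) (detᴱ (Iᴱ ⊞ᴱ σ ⊛ᴱ x)) (Κ 1φ :+ σ :* (trᴱ x :+ σ :* detᴱ x)) refl
  where
  x : MatExpr 5
  x = varᴹ 0
  σ : Expr Zφ 5
  σ = varˢ 4

evalWord-++ : ∀ u v → evalWord (u ++ v) ≡ evalWord u · evalWord v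
evalWord-++ [] v = sym (·-identityˡ (evalWord v))
evalWord-++ (l ∷ u) v = begin
  letter l · evalWord (u ++ v)          ≡⟨ cong (letter l ·_) (evalWord-++ u v) ⟩
  letter l · (evalWord u · evalWord v)  ≡⟨ ·-assoc (letter l) (evalWord u) (evalWord v) ⟨
  (letter l · evalWord u) · evalWord v  ∎
  where open ≡-Reasoning

det-gen : ∀ i → det (gen i) ≡ 1φ
det-gen zero = refl
det-gen (suc zero) = refl
det-gen (suc (suc zero)) = refl
det-gen (suc (suc (suc zero))) = refl

det-letter : ∀ l → det (letter l) ≡ 1φ
det-letter (i , false) = det-gen i
det-letter (i , true) = trans (det-adj (gen i)) (det-gen i)

Γ⊆G : ∀ {M} → InΓ M → InG M
Γ⊆G ([] , refl) = refl
Γ⊆G (l ∷ w , refl) = begin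
  det (letter l · evalWord w)        ≡⟨ det-· (letter l) (evalWord w) ⟩
  det (letter l) ⊗ det (evalWord w)  ≡⟨ cong₂ _⊗_ (det-letter l) (Γ⊆G (w , refl)) ⟩
  1φ ⊗ 1φ                            ∎
  where open ≡-Reasoning

-- Congruences modulo an element of ℤ[φ]

infix 4 _≃_[mod_]
record _≃_[mod_] (A B : Mat) (q : Zφ) : Set where
  constructor congruent
  field
    quotient : Mat
    equality : A ≡ B ⊞ q ⊛ quotient

≃-sym : ∀ {A B q} → A ≃ B [mod q ] → B ≃ A [mod q ]
≃-sym {B = B} {q} (congruent Z refl) = congruent ((⊝ 1φ) ⊛ Z)
  (proveᴹ (B ∷ᴹ Z ∷ᴹ q ∷ []) b ((b ⊞ᴱ σ ⊛ᴱ z) ⊞ᴱ σ ⊛ᴱ ((:- Κ 1φ) ⊛ᴱ z)) refl refl refl refl)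
  where
  b z : MatExpr 9
  b = varᴹ 0; z = varᴹ 4
  σ : Expr Zφ 9
  σ = varˢ 8

≃-trans : ∀ {A B C q} → A ≃ B [mod q ] → B ≃ C [mod q ] → A ≃ C [mod q ]
≃-trans {C = C} {q} (congruent Z refl) (congruent Z′ refl) = congruent (Z′ ⊞ Z)
  (proveᴹ (C ∷ᴹ Z′ ∷ᴹ Z ∷ᴹ q ∷ []) ((c ⊞ᴱ σ ⊛ᴱ z′) ⊞ᴱ σ ⊛ᴱ z) (c ⊞ᴱ σ ⊛ᴱ (z′ ⊞ᴱ z)) refl refl refl refl)
  where
  c z′ z : MatExpr 13
  c = varᴹ 0; z′ = varᴹ 4; z = varᴹ 8
  σ : Expr Zφ 13
  σ = varˢ 12

≃-·ˡ : ∀ {B C q} A → B ≃ C [mod q ] → A · B ≃ A · C [mod q ]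
≃-·ˡ {C = C} {q} A (congruent Z refl) = congruent (A · Z)
  (proveᴹ (A ∷ᴹ C ∷ᴹ Z ∷ᴹ q ∷ []) (a ·ᴱ (c ⊞ᴱ σ ⊛ᴱ z)) (a ·ᴱ c ⊞ᴱ σ ⊛ᴱ (a ·ᴱ z)) refl refl refl refl)
  where
  a c z : MatExpr 13
  a = varᴹ 0; c = varᴹ 4; z = varᴹ 8
  σ : Expr Zφ 13
  σ = varˢ 12

≃-weaken : ∀ {A B} q r → A ≃ B [mod q ⊗ r ] → A ≃ B [mod q ]
≃-weaken {B = B} q r (congruent Z refl) = congruent (r ⊛ Z)
  (cong (B ⊞_) (⊛-assoc q r Z))

adj-·-≃-I : ∀ {M q} A → InG A → A ≃ M [mod q ] → adj A · M ≃ I₂ [mod q ]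
adj-·-≃-I {M} {q} A detA A≃M =
  ≃-sym (subst (λ B → B ≃ adj A · M [mod q ]) (adj-inverseˡ A detA) (≃-·ˡ (adj A) A≃M))

≡φ⇒multiple : ∀ q x y → x ≡φ y [mod q ] → ∃ λ z → x ≡ y ⊕ (fromℤ q ⊗ z)
≡φ⇒multiple q x y (q∣re , q∣ph) =
  let divides k₀ re≡ = ∣ᵤ⇒∣ {q} q∣re
      divides k₁ ph≡ = ∣ᵤ⇒∣ {q} q∣ph
  in zφ k₀ k₁ , (begin
    x                         ≡⟨ Zφ-Ops.prove (x ∷ y ∷ []) (varˢ 0)
                                                (varˢ 1 :+ (varˢ 0 :+ :- varˢ 1)) refl ⟩
    y ⊕ (x ⊖ y)               ≡⟨ cong (y ⊕_) (cong₂ zφ (trans re≡ (ℤ.*-comm k₀ q))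
                                                       (trans ph≡ (ℤ.*-comm k₁ q))) ⟩
    y ⊕ zφ (q * k₀) (q * k₁)  ≡⟨ cong (y ⊕_) (fromℤ-⊗ q k₀ k₁) ⟨
    y ⊕ (fromℤ q ⊗ zφ k₀ k₁)  ∎)
  where open ≡-Reasoning

+multiple≡φ : ∀ q y z → (y ⊕ (fromℤ q ⊗ z)) ≡φ y [mod q ]
+multiple≡φ q y (zφ z₀ z₁) = divisor (cong re difference) , divisor (cong ph difference)
  where
  difference : (y ⊕ (fromℤ q ⊗ zφ z₀ z₁)) ⊖ y ≡ zφ (q * z₀) (q * z₁)
  difference = trans
    (Zφ-Ops.prove (y ∷ fromℤ q ⊗ zφ z₀ z₁ ∷ []) ((varˢ 0 :+ varˢ 1) :+ :- varˢ 0) (varˢ 1) refl)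
    (fromℤ-⊗ q z₀ z₁)
  divisor : ∀ {a k} → a ≡ q * k → q ∣ a
  divisor {k = k} a≡qk = ∣⇒∣ᵤ (divides k (trans a≡qk (ℤ.*-comm q k)))

≡M⇒≃ : ∀ {q M N} → M ≡M N [mod q ] → M ≃ N [mod fromℤ q ]
≡M⇒≃ {q} {M} {N} (p₁ , p₂ , p₃ , p₄) =
  let z₁ , e₁ = ≡φ⇒multiple q (m11 M) (m11 N) p₁
      z₂ , e₂ = ≡φ⇒multiple q (m12 M) (m12 N) p₂
      z₃ , e₃ = ≡φ⇒multiple q (m21 M) (m21 N) p₃
      z₄ , e₄ = ≡φ⇒multiple q (m22 M) (m22 N) p₄
  in congruent (mat z₁ z₂ z₃ z₄) (mat-cong e₁ e₂ e₃ e₄)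

≃⇒≡M : ∀ {q M N} → M ≃ N [mod fromℤ q ] → M ≡M N [mod q ]
≃⇒≡M {q} {N = N} (congruent (mat z₁ z₂ z₃ z₄) refl) =
  +multiple≡φ q (m11 N) z₁ , +multiple≡φ q (m12 N) z₂ ,
  +multiple≡φ q (m21 N) z₃ , +multiple≡φ q (m22 N) z₄

EvenTrace : Mat → Set
EvenTrace X = ∃ λ e → tr X ≡ 2φ ⊗ e

det≡1⇒evenTrace : ∀ t X → Cancellable (4φ ⊗ t) → InG (I₂ ⊞ (4φ ⊗ t) ⊛ X) → EvenTrace X
det≡1⇒evenTrace t X cancellable det≡1 = ⊝ ((2φ ⊗ t) ⊗ det X) , (begin
  tr X                         ≡⟨ inverseˡ-unique (tr X) (s ⊗ det X) (cancellable _ s⊗[trX+s⊗detX]≡0) ⟩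
  ⊝ (s ⊗ det X)                ≡⟨ Zφ-Ops.prove (t ∷ det X ∷ [])
                                    (:- ((Κ 4φ :* τ) :* δ)) (Κ 2φ :* :- ((Κ 2φ :* τ) :* δ)) refl ⟩
  2φ ⊗ (⊝ ((2φ ⊗ t) ⊗ det X))  ∎)
  where
  open ≡-Reasoning
  s : Zφ
  s = 4φ ⊗ t
  τ δ : Expr Zφ 2
  τ = varˢ 0; δ = varˢ 1
  s⊗[trX+s⊗detX]≡0 : s ⊗ (tr X ⊕ (s ⊗ det X)) ≡ 0φ
  s⊗[trX+s⊗detX]≡0 = identityʳ-unique 1φ _ (trans (sym (det-I+sX s X)) det≡1)

-- Words lifting I + 4tX modulo 8t

Lifts : Zφ → Mat → Mat → Set
Lifts t X U = U ≃ I₂ ⊞ (4φ ⊗ t) ⊛ X [mod 8φ ⊗ t ]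

-- (I + 4tY)² = I + 8tY + 16t²Y², where Y = X + 2V
lifts-square : ∀ {t X U} → Lifts t X U → Lifts (2φ ⊗ t) X (U · U)
lifts-square {t} {X} (congruent V refl) = congruent (V ⊞ t ⊛ (Y · Y))
  (proveᴹ (X ∷ᴹ V ∷ᴹ t ∷ []) (u ·ᴱ u)
    (Iᴱ ⊞ᴱ (Κ 4φ :* (Κ 2φ :* τ)) ⊛ᴱ x ⊞ᴱ (Κ 8φ :* (Κ 2φ :* τ)) ⊛ᴱ (v ⊞ᴱ τ ⊛ᴱ (y ·ᴱ y)))
    refl refl refl refl)
  where
  τ : Expr Zφ 9
  τ = varˢ 8
  Y : Mat
  Y = X ⊞ 2φ ⊛ V
  x v y u : MatExpr 9
  x = varᴹ 0; v = varᴹ 4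
  y = x ⊞ᴱ Κ 2φ ⊛ᴱ v
  u = Iᴱ ⊞ᴱ (Κ 4φ :* τ) ⊛ᴱ x ⊞ᴱ (Κ 8φ :* τ) ⊛ᴱ v

-- (I + 4tY)(I + 4tY′) = I + 4t(Y + Y′) + 16t²YY′, where Y = S + 2V and Y′ = S′ + 2V′
lifts-· : ∀ {t S S′ U U′} → Lifts t S U → Lifts t S′ U′ → Lifts t (S ⊞ S′) (U · U′)
lifts-· {t} {S} {S′} (congruent V refl) (congruent V′ refl) = congruent (V ⊞ V′ ⊞ (2φ ⊗ t) ⊛ (Y · Y′))
  (proveᴹ (S ∷ᴹ S′ ∷ᴹ V ∷ᴹ V′ ∷ᴹ t ∷ []) (u ·ᴱ u′)
    (Iᴱ ⊞ᴱ (Κ 4φ :* τ) ⊛ᴱ (s ⊞ᴱ s′) ⊞ᴱ (Κ 8φ :* τ) ⊛ᴱ (v ⊞ᴱ v′ ⊞ᴱ (Κ 2φ :* τ) ⊛ᴱ (y ·ᴱ y′)))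
    refl refl refl refl)
  where
  τ : Expr Zφ 17
  τ = varˢ 16
  Y Y′ : Mat
  Y = S ⊞ 2φ ⊛ V
  Y′ = S′ ⊞ 2φ ⊛ V′
  s s′ v v′ y y′ u u′ : MatExpr 17
  s = varᴹ 0; s′ = varᴹ 4; v = varᴹ 8; v′ = varᴹ 12
  y = s ⊞ᴱ Κ 2φ ⊛ᴱ v
  y′ = s′ ⊞ᴱ Κ 2φ ⊛ᴱ v′
  u = Iᴱ ⊞ᴱ (Κ 4φ :* τ) ⊛ᴱ s ⊞ᴱ (Κ 8φ :* τ) ⊛ᴱ v
  u′ = Iᴱ ⊞ᴱ (Κ 4φ :* τ) ⊛ᴱ s′ ⊞ᴱ (Κ 8φ :* τ) ⊛ᴱ v′

lifts-mod2 : ∀ {t X S U} → X ≃ S [mod 2φ ] → Lifts t S U → Lifts t X U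
lifts-mod2 {t} {S = S} (congruent R refl) (congruent V refl) = congruent (V ⊞ (⊝ 1φ) ⊛ R)
  (proveᴹ (S ∷ᴹ R ∷ᴹ V ∷ᴹ t ∷ [])
    (Iᴱ ⊞ᴱ (Κ 4φ :* τ) ⊛ᴱ s ⊞ᴱ (Κ 8φ :* τ) ⊛ᴱ v)
    (Iᴱ ⊞ᴱ (Κ 4φ :* τ) ⊛ᴱ (s ⊞ᴱ Κ 2φ ⊛ᴱ r) ⊞ᴱ (Κ 8φ :* τ) ⊛ᴱ (v ⊞ᴱ (:- Κ 1φ) ⊛ᴱ r))
    refl refl refl refl)
  where
  τ : Expr Zφ 13
  τ = varˢ 12
  s r v : MatExpr 13
  s = varᴹ 0; r = varᴹ 4; v = varᴹ 8

record Realisable (t : Zφ) (X : Mat) : Set where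
  constructor realisable
  field
    word : List (Fin 4 × Bool)
    lifts : Lifts t X (evalWord word)

realisable-⊞ : ∀ {t S S′} → Realisable t S → Realisable t S′ → Realisable t (S ⊞ S′)
realisable-⊞ {t} {S} {S′} (realisable u L) (realisable u′ L′) =
  realisable (u ++ u′) (subst (Lifts t (S ⊞ S′)) (sym (evalWord-++ u u′)) (lifts-· {t} {S} {S′} L L′))

realisable-mod2 : ∀ {t X S} → X ≃ S [mod 2φ ] → Realisable t S → Realisable t X
realisable-mod2 {t} {X} {S} X≃S (realisable u L) = realisable u (lifts-mod2 {t} {X} {S} X≃S L)

realisable-square : ∀ {t X} → Realisable t X → Realisable (2φ ⊗ t) X
realisable-square {t} {X} (realisable u L) =
  realisable (u ++ u) (subst (Lifts (2φ ⊗ t) X) (sym (evalWord-++ u u)) (lifts-square {t} {X} L))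

-- The case t = 1

data Position : Set where
  diagonal upper lower : Position

unit : Position → Mat
unit diagonal = I₂
unit upper = mat 0φ 1φ 0φ 0φ
unit lower = mat 0φ 0φ 1φ 0φ

positive : List (Fin 4) → List (Fin 4 × Bool)
positive = map (_, false)

-- Each quotient is (evalWord w − I − 4Y) / 8, for Y the matrix being realised.
realisable-1 : ∀ p → Realisable 1φ (1φ ⊛ unit p)
realisable-1 diagonal = realisable (positive (# 3 ∷ # 2 ∷ # 1 ∷ # 2 ∷ # 3 ∷ # 0 ∷ []))
  (congruent (mat (zφ (+ 2) (+ 4)) (zφ (+ 6) (+ 10)) (zφ (+ 3) (+ 5)) (zφ (+ 7) (+ 12))) refl)
realisable-1 upper = realisable (positive (# 1 ∷ # 2 ∷ # 1 ∷ # 1 ∷ # 2 ∷ # 1 ∷ # 0 ∷ # 0 ∷ []))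
  (congruent (mat (zφ (+ 1) (+ 2)) (zφ (+ 4) (+ 7)) (zφ (+ 3) (+ 5)) (zφ (+ 11) (+ 18))) refl)
realisable-1 lower = realisable (positive (# 0 ∷ # 2 ∷ # 1 ∷ # 3 ∷ # 3 ∷ # 1 ∷ # 2 ∷ # 0 ∷ []))
  (congruent (mat (zφ (+ 10) (+ 16)) (zφ (+ 27) (+ 44)) (zφ (+ 3) (+ 6)) (zφ (+ 10) (+ 16))) refl)

realisable-φ : ∀ p → Realisable 1φ (φ ⊛ unit p)
realisable-φ diagonal = realisable (positive (# 2 ∷ # 1 ∷ # 2 ∷ # 1 ∷ # 2 ∷ # 0 ∷ # 1 ∷ # 0 ∷ []))
  (congruent (mat (zφ (+ 9) (+ 14)) (zφ (+ 19) (+ 31)) (zφ (+ 8) (+ 13)) (zφ (+ 17) (+ 27))) refl)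
realisable-φ upper = realisable (positive (# 0 ∷ # 0 ∷ # 0 ∷ # 0 ∷ [])) (congruent 0M refl)
realisable-φ lower = realisable (positive (# 1 ∷ # 1 ∷ # 1 ∷ # 1 ∷ [])) (congruent 0M refl)

realisable-residue : ∀ p m n → m ℕ.< 2 → n ℕ.< 2 → Realisable 1φ (zφ (+ m) (+ n) ⊛ unit p)
realisable-residue p 0 0 _ _ =
  subst (Realisable 1φ) (sym (⊛-zeroˡ (unit p))) (realisable [] (congruent 0M refl))
realisable-residue p 1 0 _ _ = realisable-1 p
realisable-residue p 0 1 _ _ = realisable-φ p
realisable-residue p 1 1 _ _ =
  subst (Realisable 1φ) (sym (⊛-distribʳ 1φ φ (unit p))) (realisable-⊞ (realisable-1 p) (realisable-φ p))
realisable-residue p (ℕ.suc (ℕ.suc _)) _ (ℕ.s≤s (ℕ.s≤s ())) _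
realisable-residue p _ (ℕ.suc (ℕ.suc _)) _ (ℕ.s≤s (ℕ.s≤s ()))

residue half : Zφ → Zφ
residue (zφ a b) = zφ (+ (a %ℕ 2)) (+ (b %ℕ 2))
half (zφ a b) = zφ (a /ℕ 2) (b /ℕ 2)

parity-split : ∀ a → a ≡ + (a %ℕ 2) + + 2 * (a /ℕ 2)
parity-split a = trans (a≡a%ℕn+[a/ℕn]*n a 2) (cong (λ h → + (a %ℕ 2) + h) (ℤ.*-comm (a /ℕ 2) (+ 2)))

residue+2half : ∀ x → x ≡ residue x ⊕ (2φ ⊗ half x)
residue+2half (zφ a b) = trans (cong₂ zφ (parity-split a) (parity-split b))
  (cong (residue (zφ a b) ⊕_) (sym (fromℤ-⊗ (+ 2) (a /ℕ 2) (b /ℕ 2))))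

multiple≃residue : ∀ p x → x ⊛ unit p ≃ residue x ⊛ unit p [mod 2φ ]
multiple≃residue p x = congruent (half x ⊛ unit p) (begin
  x ⊛ unit p                                   ≡⟨ cong (_⊛ unit p) (residue+2half x) ⟩
  (residue x ⊕ (2φ ⊗ half x)) ⊛ unit p         ≡⟨ ⊛-distribʳ (residue x) (2φ ⊗ half x) (unit p) ⟩
  residue x ⊛ unit p ⊞ (2φ ⊗ half x) ⊛ unit p  ≡⟨ cong (residue x ⊛ unit p ⊞_)
                                                      (⊛-assoc 2φ (half x) (unit p)) ⟩
  residue x ⊛ unit p ⊞ 2φ ⊛ half x ⊛ unit p    ∎)
  where open ≡-Reasoning

realisable-multiple : ∀ p x → Realisable 1φ (x ⊛ unit p)
realisable-multiple p x =
  realisable-mod2 (multiple≃residue p x) (realisable-residue p _ _ (n%ℕd<d (re x) 2) (n%ℕd<d (ph x) 2))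

evenTrace⇒≃units : ∀ {X} → EvenTrace X →
  X ≃ m11 X ⊛ unit diagonal ⊞ m12 X ⊛ unit upper ⊞ m21 X ⊛ unit lower [mod 2φ ]
evenTrace⇒≃units {mat a b c d} (e , a⊕d≡2e) = congruent (mat 0φ 0φ 0φ (e ⊕ (⊝ a))) (begin
  mat a b c d                   ≡⟨ cong (mat a b c) d≡ ⟩
  mat a b c ((⊝ a) ⊕ (2φ ⊗ e))  ≡⟨ proveᴹ (a ∷ b ∷ c ∷ e ∷ []) (matᴱ α β γ (:- α :+ Κ 2φ :* ε))
                                     (α ⊛ᴱ Iᴱ ⊞ᴱ β ⊛ᴱ constᴹ (unit upper) ⊞ᴱ γ ⊛ᴱ constᴹ (unit lower)
                                        ⊞ᴱ Κ 2φ ⊛ᴱ matᴱ (Κ 0φ) (Κ 0φ) (Κ 0φ) (ε :+ :- α))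
                                     refl refl refl refl ⟩
  a ⊛ unit diagonal ⊞ b ⊛ unit upper ⊞ c ⊛ unit lower ⊞ 2φ ⊛ mat 0φ 0φ 0φ (e ⊕ (⊝ a))  ∎)
  where
  open ≡-Reasoning
  α β γ ε : Expr Zφ 4
  α = varˢ 0; β = varˢ 1; γ = varˢ 2; ε = varˢ 3
  d≡ : d ≡ (⊝ a) ⊕ (2φ ⊗ e)
  d≡ = trans (Zφ-Ops.prove (a ∷ d ∷ []) (varˢ 1) (:- varˢ 0 :+ (varˢ 0 :+ varˢ 1)) refl)
             (cong ((⊝ a) ⊕_) a⊕d≡2e)

realisable-mod8 : ∀ {X} → EvenTrace X → Realisable 1φ X
realisable-mod8 {X} even = realisable-mod2 (evenTrace⇒≃units even)
  (realisable-⊞ (realisable-⊞ (realisable-multiple diagonal (m11 X)) (realisable-multiple upper (m12 X)))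
                (realisable-multiple lower (m21 X)))

pow2 : ℕ → Zφ
pow2 ℕ.zero = 1φ
pow2 (ℕ.suc j) = 2φ ⊗ pow2 j

pow2≡fromℤ : ∀ j → pow2 j ≡ fromℤ (+ (2 ^ j))
pow2≡fromℤ ℕ.zero = refl
pow2≡fromℤ (ℕ.suc j) = begin
  2φ ⊗ pow2 j                 ≡⟨ cong (2φ ⊗_) (pow2≡fromℤ j) ⟩
  2φ ⊗ fromℤ (+ (2 ^ j))      ≡⟨ fromℤ-⊗ (+ 2) (+ (2 ^ j)) (+ 0) ⟩
  fromℤ (+ 2 * + (2 ^ j))     ≡⟨ cong fromℤ (ℤ.pos-* 2 (2 ^ j)) ⟨
  fromℤ (+ (2 ^ ℕ.suc j))     ∎
  where open ≡-Reasoning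

4φ⊗pow2≡fromℤ : ∀ j → 4φ ⊗ pow2 j ≡ fromℤ (+ (2 ^ (2 ℕ.+ j)))
4φ⊗pow2≡fromℤ j = trans (⊗-assoc 2φ 2φ (pow2 j)) (pow2≡fromℤ (2 ℕ.+ j))

4φ⊗pow2-cancellable : ∀ j → Cancellable (4φ ⊗ pow2 j)
4φ⊗pow2-cancellable j =
  subst Cancellable (sym (4φ⊗pow2≡fromℤ j)) (fromℤ-cancellable (+ (2 ^ (2 ℕ.+ j))) {{m^n≢0 2 (2 ℕ.+ j)}})

realisable-pow2 : ∀ j {X} → EvenTrace X → Realisable (pow2 j) X
realisable-pow2 ℕ.zero even = realisable-mod8 even
realisable-pow2 (ℕ.suc j) even = realisable-square (realisable-pow2 j even)

layer-surjective : ∀ j {N} → InG N → N ≃ I₂ [mod 4φ ⊗ pow2 j ] →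
                   ∃ λ u → evalWord u ≃ N [mod 8φ ⊗ pow2 j ]
layer-surjective j detN (congruent X refl) =
  let realisable u U≃N = realisable-pow2 j (det≡1⇒evenTrace (pow2 j) X (4φ⊗pow2-cancellable j) detN)
  in u , U≃N

approximation-step : ∀ j {M} w → InG M → evalWord w ≃ M [mod 4φ ⊗ pow2 j ] →
                     ∃ λ w′ → evalWord w′ ≃ M [mod 4φ ⊗ pow2 (ℕ.suc j) ]
approximation-step j {M} w detM A≃M =
  let u , U≃N = layer-surjective j (adj-·-inG A M detA detM) (adj-·-≃-I A detA A≃M)
  in w ++ u , subst₂ (λ B q → B ≃ M [mod q ]) (sym (evalWord-++ w u)) (⊗-assoc 4φ 2φ (pow2 j))
                (subst (λ B → A · evalWord u ≃ B [mod 8φ ⊗ pow2 j ]) (·-adj-·-cancel A M detA)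
                       (≃-·ˡ A U≃N))
  where
  A : Mat
  A = evalWord w
  detA : InG A
  detA = Γ⊆G (w , refl)

approximate : ∀ {M} → InG M → M ≃ I₂ [mod 4φ ] → ∀ j → ∃ λ w → evalWord w ≃ M [mod 4φ ⊗ pow2 j ]
approximate detM M≃I ℕ.zero = [] , ≃-sym M≃I
approximate detM M≃I (ℕ.suc j) =
  let w , A≃M = approximate detM M≃I j in approximation-step j w detM A≃M

Γ₄-image⊆G₄-image : ∀ q X → InImage (Level InΓ (+ 4)) q X → InImage (Level InG (+ 4)) q X
Γ₄-image⊆G₄-image q X (M , (M∈Γ , M≡I) , M≡X) = M , (Γ⊆G M∈Γ , M≡I) , M≡X

G₄-image⊆Γ₄-image : ∀ j X → InImage (Level InG (+ 4)) (+ (2 ^ (2 ℕ.+ j))) X →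
                             InImage (Level InΓ (+ 4)) (+ (2 ^ (2 ℕ.+ j))) X
G₄-image⊆Γ₄-image j X (M , (detM , M≡I) , M≡X) = Γ-witness (approximate detM (≡M⇒≃ M≡I) j)
  where
  Γ-witness : (∃ λ w → evalWord w ≃ M [mod 4φ ⊗ pow2 j ]) →
              InImage (Level InΓ (+ 4)) (+ (2 ^ (2 ℕ.+ j))) X
  Γ-witness (w , A≃M) = evalWord w , ((w , refl) , ≃⇒≡M A≃I) , ≃⇒≡M A≃X
    where
    A≃I : evalWord w ≃ I₂ [mod 4φ ]
    A≃I = ≃-trans (≃-weaken 4φ (pow2 j) A≃M) (≡M⇒≃ M≡I)
    A≃X : evalWord w ≃ X [mod fromℤ (+ (2 ^ (2 ℕ.+ j))) ]
    A≃X = ≃-trans (subst (λ q → evalWord w ≃ M [mod q ]) (4φ⊗pow2≡fromℤ j) A≃M) (≡M⇒≃ M≡X)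

lemma3p3 : (s : ℕ) → 2 ≤ s → (X : Mat) →
    (InImage (Level InΓ (+ 4)) (+ (2 ^ s)) X → InImage (Level InG (+ 4)) (+ (2 ^ s)) X) ×
    (InImage (Level InG (+ 4)) (+ (2 ^ s)) X → InImage (Level InΓ (+ 4)) (+ (2 ^ s)) X)
lemma3p3 (ℕ.suc (ℕ.suc j)) (ℕ.s≤s (ℕ.s≤s ℕ.z≤n)) X =
  Γ₄-image⊆G₄-image (+ (2 ^ (2 ℕ.+ j))) X , G₄-image⊆Γ₄-image j X
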